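{- For all integers $n\geq 3$ and $t\geq 1$, the directed $(n,t)$-tadpole admits a strong$^*$ SV$(n+t+1,1)$AL, i.e. a total labeling with $\lambda(A)=\{1,\ldots,|A|\}$ whose subtractive vertex-weights are exactly $n+t+1,n+t+2,\ldots,2n+2t$.
   Context: The directed $(n,t)$-tadpole has vertices $v_1,\ldots,v_n,u_1,\ldots,u_t$ and arcs $v_iv_{i+1}$ ($1\le i\le n-1$), $v_nv_1$, $u_iu_{i+1}$ ($1\le i\le t-1$), and $u_tv_1$. For a digraph $G=(V,A)$, a total labeling is a bijection $\lambda:V\cup A\to\{1,2,\ldots,|V|+|A|\}$. For a vertex $x$, $wt^-(x)=\lambda(x)+\sum_{yx\in A}\lambda(yx)-\sum_{xy\in A}\lambda(xy)$. An SV$(a,d)$AL is a total labeling whose set of vertex-weights is $\{a,a+d,\ldots,a+(|V|-1)d\}$ (all distinct). A total labeling is strong$^*$ if $\lambda(A)=\{1,\ldots,|A|\}$. -}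

module Defs where

open import Data.Nat using (ℕ; zero; suc; _+_; _≤_; _<_)
open import Data.Fin using (Fin; zero; suc; toℕ; fromℕ<; _↑ˡ_; _↑ʳ_; splitAt; _≟_)
open import Data.Sum using (_⊎_; inj₁; inj₂)
open import Data.Product using (_×_; _,_; proj₁; proj₂; ∃)
open import Data.Bool using (if_then_else_)
open import Data.Integer as ℤ using (ℤ; +_)
open import Relation.Nullary.Decidable using (⌊_⌋; yes; no)
open import Relation.Binary.PropositionalEquality using (_≡_)
import Data.Nat.Properties as ℕP

record Digraph : Set where
  field
    nV  : ℕ
    nA  : ℕ
    src : Fin nA → Fin nV
    tgt : Fin nA → Fin nV
open Digraph public

next : ∀ {n} → Fin n → Fin n
next {suc m} i with suc (toℕ i) ℕP.<? suc m
... | yes p = fromℕ< p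
... | no _ = zero

-- Vertex v_{i+1} is (i ↑ˡ t) for i : Fin n,
-- vertex u_{j+1} is (n ↑ʳ j) for j : Fin t.
-- Arc (i ↑ˡ t) is v_{i+1} v_{i+2} (indices mod n, so the last one is v_n v_1);
-- arc (n ↑ʳ j) is u_{j+1} u_{j+2} for j+1 < t, and u_t v_1 for j+1 = t.
-- the vertex v_1 (for n ≥ 1; degenerate fallback for n = 0, never used when n ≥ 3)
firstV : ∀ n t → Fin t → Fin (n + t)
firstV zero    t j = j
firstV (suc n) t j = zero

uNext : ∀ n t → Fin t → Fin (n + t)
uNext n t j with suc (toℕ j) ℕP.<? t
... | yes p = n ↑ʳ fromℕ< p
... | no _  = firstV n t j

tadArc : ∀ n t → Fin (n + t) → Fin (n + t) × Fin (n + t)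
tadArc n t a with splitAt n a
... | inj₁ i = (i ↑ˡ t) , (next i ↑ˡ t)
... | inj₂ j = (n ↑ʳ j) , uNext n t j

tadpole : ℕ → ℕ → Digraph
tadpole n t = record
  { nV = n + t ; nA = n + t
  ; src = λ a → proj₁ (tadArc n t a)
  ; tgt = λ a → proj₂ (tadArc n t a) }

sumFin : ∀ {k} → (Fin k → ℤ) → ℤ
sumFin {zero}  f = + 0
sumFin {suc k} f = f zero ℤ.+ sumFin (λ i → f (suc i))

IsTotalLabeling : (G : Digraph) → (Fin (nV G) ⊎ Fin (nA G) → ℕ) → Set
IsTotalLabeling G lab =
    (∀ x y → lab x ≡ lab y → x ≡ y)
  × (∀ x → 1 ≤ lab x × lab x ≤ nV G + nA G)
  × (∀ k → 1 ≤ k → k ≤ nV G + nA G → ∃ λ x → lab x ≡ k)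

IsStrongStar : (G : Digraph) → (Fin (nV G) ⊎ Fin (nA G) → ℕ) → Set
IsStrongStar G lab =
    (∀ a → 1 ≤ lab (inj₂ a) × lab (inj₂ a) ≤ nA G)
  × (∀ k → 1 ≤ k → k ≤ nA G → ∃ λ a → lab (inj₂ a) ≡ k)

wt⁻ : (G : Digraph) → (Fin (nV G) ⊎ Fin (nA G) → ℕ) → Fin (nV G) → ℤ
wt⁻ G lab x =
  (+ lab (inj₁ x))
  ℤ.+ sumFin (λ a → if ⌊ tgt G a ≟ x ⌋ then + lab (inj₂ a) else + 0)
  ℤ.- sumFin (λ a → if ⌊ src G a ≟ x ⌋ then + lab (inj₂ a) else + 0)

IsSVAL : (G : Digraph) → ℤ → ℤ → (Fin (nV G) ⊎ Fin (nA G) → ℕ) → Set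
IsSVAL G a d lab =
    IsTotalLabeling G lab
  × (∀ x y → wt⁻ G lab x ≡ wt⁻ G lab y → x ≡ y)
  × (∀ x → ∃ λ k → k < nV G × wt⁻ G lab x ≡ a ℤ.+ (+ k) ℤ.* d)
  × (∀ k → k < nV G → ∃ λ x → wt⁻ G lab x ≡ a ℤ.+ (+ k) ℤ.* d)

-- Number the vertices v₁ … vₙ u₁ … u_t by 0 … N − 1 (N = n + t) and give each arc the number of its
-- tail. Vertex k gets the label N + 1 + k; the cycle arcs v₁v₂, …, vₙv₁ get t + 1, …, t + n and the tail
-- arcs u₁u₂, …, u_t v₁ get 1, …, t, i.e. the arc numbering rotated by t places, so the labeling is a
-- strong* total labeling. Along both directed paths consecutive arc labels differ by one, so every vertex
-- other than v₁ and u₁ has weight equal to its label minus one; u₁ has no in-arc and out-label 1, and v₁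
-- receives t + n and t against t + 1. Hence the weights are the vertex labels rotated back by one place.
module Submission where

open import Defs
open import Data.Nat using (ℕ; zero; suc; _+_; _∸_; _≤_; _<_; z≤n; s≤s; z<s)
open import Data.Nat.Properties as ℕ using (+-comm; +-suc)
open import Data.Fin
  using (Fin; zero; suc; toℕ; fromℕ; fromℕ<; inject₁; join; splitAt; reduce≥; cast; _↑ˡ_; _↑ʳ_; _≟_)
open import Data.Fin.Properties
  using (+↔⊎; suc-injective; toℕ-cast; cast-involutive; toℕ-injective; toℕ<n; toℕ-fromℕ; toℕ-fromℕ<;
         toℕ-inject₁; toℕ-↑ˡ; toℕ-↑ʳ; splitAt-<; splitAt-≥; splitAt⁻¹-↑ˡ; splitAt⁻¹-↑ʳ)
open import Data.Integer as ℤ using (ℤ; +_)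
open import Data.Integer.Properties as ℤ using ()
open import Data.Sum using (_⊎_; inj₁; inj₂; swap; [_,_]′)
open import Data.Sum.Properties using (swap-↔)
open import Data.Sum.Function.Propositional using (_⊎-↔_)
open import Data.Product using (_×_; _,_; proj₁; proj₂; ∃; map₂)
open import Data.Bool using (if_then_else_)
open import Function using (_∘_)
open import Function.Bundles using (Inverse; Injection; Equivalence; _↔_; _⇔_; mk↔ₛ′; mk⇔)
open import Function.Properties.Inverse using (↔-refl; ↔-sym; ↔-trans; Inverse⇒Injection)
open import Relation.Nullary using (yes; no; contradiction)
open import Relation.Nullary.Decidable using (⌊_⌋; dec-true; dec-false; isYes≗does)
open import Relation.Binary.PropositionalEquality
open import Data.Nat.Tactic.RingSolver using (solve-∀)
open import Relation.Binary.Definitions using (tri<; tri≈; tri>)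

open ≡-Reasoning

sumFin-zero : ∀ {K} (h : Fin K → ℤ) → (∀ e → h e ≡ + 0) → sumFin h ≡ + 0
sumFin-zero {zero}  h h≡0 = refl
sumFin-zero {suc K} h h≡0 = cong₂ ℤ._+_ (h≡0 zero) (sumFin-zero (h ∘ suc) (h≡0 ∘ suc))

sumFin-single : ∀ {K} (h : Fin K → ℤ) (p : Fin K) → (∀ e → e ≢ p → h e ≡ + 0) → sumFin h ≡ h p
sumFin-single h zero h≡0 = begin
  h zero ℤ.+ sumFin (h ∘ suc) ≡⟨ cong (λ s → h zero ℤ.+ s) (sumFin-zero (h ∘ suc) (λ e → h≡0 (suc e) λ ())) ⟩
  h zero ℤ.+ + 0              ≡⟨ ℤ.+-identityʳ (h zero) ⟩
  h zero                      ∎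
sumFin-single h (suc p) h≡0 = begin
  h zero ℤ.+ sumFin (h ∘ suc) ≡⟨ cong₂ ℤ._+_ (h≡0 zero λ ())
                                   (sumFin-single (h ∘ suc) p λ e e≢p → h≡0 (suc e) (e≢p ∘ suc-injective)) ⟩
  + 0 ℤ.+ h (suc p)           ≡⟨ ℤ.+-identityˡ (h (suc p)) ⟩
  h (suc p)                   ∎

sumFin-pair : ∀ {K} (h : Fin K → ℤ) (p q : Fin K) → p ≢ q →
              (∀ e → e ≢ p → e ≢ q → h e ≡ + 0) → sumFin h ≡ h p ℤ.+ h q
sumFin-pair h zero zero p≢q _ = contradiction refl p≢q
sumFin-pair h zero (suc q) _ h≡0 =
  cong (λ s → h zero ℤ.+ s) (sumFin-single (h ∘ suc) q λ e e≢q → h≡0 (suc e) (λ ()) (e≢q ∘ suc-injective))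
sumFin-pair h (suc p) zero p≢q h≡0 = begin
  sumFin h                  ≡⟨ sumFin-pair h zero (suc p) (p≢q ∘ sym) (λ e e≢0 e≢p → h≡0 e e≢p e≢0) ⟩
  h zero ℤ.+ h (suc p)      ≡⟨ ℤ.+-comm (h zero) (h (suc p)) ⟩
  h (suc p) ℤ.+ h zero      ∎
sumFin-pair h (suc p) (suc q) p≢q h≡0 = begin
  h zero ℤ.+ sumFin (h ∘ suc)   ≡⟨ cong₂ ℤ._+_ (h≡0 zero (λ ()) (λ ())) (sumFin-pair (h ∘ suc) p q (p≢q ∘ cong suc)
                                     λ e e≢p e≢q → h≡0 (suc e) (e≢p ∘ suc-injective) (e≢q ∘ suc-injective)) ⟩
  + 0 ℤ.+ (h (suc p) ℤ.+ h (suc q)) ≡⟨ ℤ.+-identityˡ _ ⟩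
  h (suc p) ℤ.+ h (suc q)       ∎

fibreSum : ∀ {K V} → (Fin K → Fin V) → (Fin K → ℤ) → Fin V → ℤ
fibreSum f g x = sumFin (λ e → if ⌊ f e ≟ x ⌋ then g e else + 0)

module _ {K V} (f : Fin K → Fin V) (g : Fin K → ℤ) (x : Fin V) where

  private
    outside : ∀ e → f e ≢ x → (if ⌊ f e ≟ x ⌋ then g e else + 0) ≡ + 0
    outside e fe≢x = cong (if_then g e else + 0) (trans (isYes≗does (f e ≟ x)) (dec-false (f e ≟ x) fe≢x))

    inside : ∀ e → f e ≡ x → (if ⌊ f e ≟ x ⌋ then g e else + 0) ≡ g e
    inside e fe≡x = cong (if_then g e else + 0) (trans (isYes≗does (f e ≟ x)) (dec-true (f e ≟ x) fe≡x))

  fibreSum-empty : (∀ e → f e ≢ x) → fibreSum f g x ≡ + 0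
  fibreSum-empty empty = sumFin-zero _ λ e → outside e (empty e)

  fibreSum-single : ∀ p → f p ≡ x → (∀ e → f e ≡ x → e ≡ p) → fibreSum f g x ≡ g p
  fibreSum-single p fp≡x fibre = begin
    fibreSum f g x ≡⟨ sumFin-single _ p (λ e e≢p → outside e (e≢p ∘ fibre e)) ⟩
    _              ≡⟨ inside p fp≡x ⟩
    g p            ∎

  fibreSum-pair : ∀ p q → p ≢ q → f p ≡ x → f q ≡ x → (∀ e → f e ≡ x → e ≡ p ⊎ e ≡ q) →
                  fibreSum f g x ≡ g p ℤ.+ g q
  fibreSum-pair p q p≢q fp≡x fq≡x fibre = begin
    fibreSum f g x ≡⟨ sumFin-pair _ p q p≢q (λ e e≢p e≢q → outside e (λ fe≡x → [ e≢p , e≢q ]′ (fibre e fe≡x))) ⟩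
    _              ≡⟨ cong₂ ℤ._+_ (inside p fp≡x) (inside q fq≡x) ⟩
    g p ℤ.+ g q    ∎

arcValue : (G : Digraph) → (Fin (nV G) ⊎ Fin (nA G) → ℕ) → Fin (nA G) → ℤ
arcValue G lab a = + lab (inj₂ a)

inflow outflow : (G : Digraph) → (Fin (nV G) ⊎ Fin (nA G) → ℕ) → Fin (nV G) → ℤ
inflow  G lab = fibreSum (tgt G) (arcValue G lab)
outflow G lab = fibreSum (src G) (arcValue G lab)

-- The flow balance i + m ≡ o + w is stated additively to avoid truncated subtraction.
wt⁻-fromFlows : ∀ G lab x {c m i o w} → lab (inj₁ x) ≡ c + m → inflow G lab x ≡ + i → outflow G lab x ≡ + o →
        i + m ≡ o + w → wt⁻ G lab x ≡ + (c + w)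
wt⁻-fromFlows G lab x {c} {m} {i} {o} {w} vertex in≡ out≡ balance = begin
  wt⁻ G lab x                       ≡⟨ cong₂ (λ u v → u ℤ.- v) (cong₂ ℤ._+_ (cong +_ vertex) in≡) out≡ ⟩
  + (c + m) ℤ.+ + i ℤ.- + o         ≡⟨ cong (ℤ._- + o) (sym (ℤ.pos-+ (c + m) i)) ⟩
  + (c + m + i) ℤ.- + o             ≡⟨ cong (λ k → + k ℤ.- + o) total ⟩
  + (c + w + o) ℤ.- + o             ≡⟨ ℤ.m-n≡m⊖n (c + w + o) o ⟩
  (c + w + o) ℤ.⊖ o                 ≡⟨ ℤ.⊖-≥ (ℕ.m≤n+m o (c + w)) ⟩
  + (c + w + o ∸ o)                 ≡⟨ cong +_ (ℕ.m+n∸n≡m (c + w) o) ⟩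
  + (c + w)                         ∎
  where
  total : c + m + i ≡ c + w + o
  total = begin
    c + m + i   ≡⟨ ℕ.+-assoc c m i ⟩
    c + (m + i) ≡⟨ cong (λ k → c + k) (trans (+-comm m i) (trans balance (+-comm o w))) ⟩
    c + (w + o) ≡⟨ ℕ.+-assoc c w o ⟨
    c + w + o   ∎

toℕ-reduce≥ : ∀ m {n} (i : Fin (m + n)) (m≤i : m ≤ toℕ i) → toℕ (reduce≥ i m≤i) ≡ toℕ i ∸ m
toℕ-reduce≥ zero    i       _         = refl
toℕ-reduce≥ (suc m) (suc i) (s≤s m≤i) = toℕ-reduce≥ m i m≤i

cast↔ : ∀ {m n} → m ≡ n → Fin m ↔ Fin n
cast↔ eq = mk↔ₛ′ (cast eq) (cast (sym eq)) (cast-involutive eq (sym eq)) (cast-involutive (sym eq) eq)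

-- Moves the first m elements of Fin (m + n) behind the last n.
rotate↔ : ∀ m n → Fin (m + n) ↔ Fin (m + n)
rotate↔ m n = ↔-trans (+↔⊎ {m} {n}) (↔-trans swap-↔ (↔-trans (↔-sym (+↔⊎ {n} {m})) (cast↔ (+-comm n m))))

rotate : ∀ m n → Fin (m + n) → Fin (m + n)
rotate m n = Inverse.to (rotate↔ m n)

toℕ-rotate-< : ∀ m n (i : Fin (m + n)) → toℕ i < m → toℕ (rotate m n i) ≡ n + toℕ i
toℕ-rotate-< m n i i<m = begin
  toℕ (rotate m n i)                   ≡⟨ toℕ-cast (+-comm n m) _ ⟩
  toℕ (join n m (swap (splitAt m i)))  ≡⟨ cong (toℕ ∘ join n m ∘ swap) (splitAt-< m i i<m) ⟩
  toℕ (n ↑ʳ fromℕ< i<m)                ≡⟨ toℕ-↑ʳ n (fromℕ< i<m) ⟩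
  n + toℕ (fromℕ< i<m)                 ≡⟨ cong (λ k → n + k) (toℕ-fromℕ< i<m) ⟩
  n + toℕ i                            ∎

toℕ-rotate-≥ : ∀ m n (i : Fin (m + n)) → m ≤ toℕ i → toℕ (rotate m n i) ≡ toℕ i ∸ m
toℕ-rotate-≥ m n i m≤i = begin
  toℕ (rotate m n i)                   ≡⟨ toℕ-cast (+-comm n m) _ ⟩
  toℕ (join n m (swap (splitAt m i)))  ≡⟨ cong (toℕ ∘ join n m ∘ swap) (splitAt-≥ m i m≤i) ⟩
  toℕ (reduce≥ i m≤i ↑ˡ m)             ≡⟨ toℕ-↑ˡ (reduce≥ i m≤i) m ⟩
  toℕ (reduce≥ i m≤i)                  ≡⟨ toℕ-reduce≥ m i m≤i ⟩
  toℕ i ∸ m                            ∎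

module _ {A : Set} {M : ℕ} (φ : A ↔ Fin M) where
  open Inverse φ

  toℕ∘to-injective : ∀ {x y} → toℕ (to x) ≡ toℕ (to y) → x ≡ y
  toℕ∘to-injective = Injection.injective (Inverse⇒Injection φ) ∘ toℕ-injective

  toℕ∘to-onto : ∀ k → k < M → ∃ λ x → toℕ (to x) ≡ k
  toℕ∘to-onto k k<M = from (fromℕ< k<M) , trans (cong toℕ (strictlyInverseˡ (fromℕ< k<M))) (toℕ-fromℕ< k<M)

  rank : A → ℕ
  rank x = suc (toℕ (to x))

  rank-injective : ∀ x y → rank x ≡ rank y → x ≡ y
  rank-injective x y = toℕ∘to-injective ∘ ℕ.suc-injective

  rank-bounded : ∀ x → 1 ≤ rank x × rank x ≤ M
  rank-bounded x = s≤s z≤n , toℕ<n (to x)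

  rank-onto : ∀ k → 1 ≤ k → k ≤ M → ∃ λ x → rank x ≡ k
  rank-onto (suc k) _ k<M = map₂ (cong suc) (toℕ∘to-onto k k<M)

isSVAL-fromWeights : ∀ G lab (π : Fin (nV G) ↔ Fin (nV G)) {c} → IsTotalLabeling G lab →
  (∀ x → wt⁻ G lab x ≡ + (c + toℕ (Inverse.to π x))) → IsSVAL G (+ c) (+ 1) lab
isSVAL-fromWeights G lab π {c} total weight = total , injective , inRange , onto
  where
  progression : ∀ k → + c ℤ.+ + k ℤ.* + 1 ≡ + (c + k)
  progression k = trans (cong (λ z → + c ℤ.+ z) (ℤ.*-identityʳ (+ k))) (sym (ℤ.pos-+ c k))
  injective : ∀ x y → wt⁻ G lab x ≡ wt⁻ G lab y → x ≡ y
  injective x y wx≡wy =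
    toℕ∘to-injective π (ℕ.+-cancelˡ-≡ c _ _ (ℤ.+-injective (trans (sym (weight x)) (trans wx≡wy (weight y)))))
  inRange : ∀ x → ∃ λ k → k < nV G × wt⁻ G lab x ≡ + c ℤ.+ + k ℤ.* + 1
  inRange x = toℕ (Inverse.to π x) , toℕ<n _ , trans (weight x) (sym (progression _))
  onto : ∀ k → k < nV G → ∃ λ x → wt⁻ G lab x ≡ + c ℤ.+ + k ℤ.* + 1
  onto k k<V with x , πx≡k ← toℕ∘to-onto π k k<V =
    x , trans (weight x) (trans (cong (λ j → + (c + j)) πx≡k) (sym (progression k)))

tadpole-src : ∀ n t (e : Fin (n + t)) → src (tadpole n t) e ≡ e
tadpole-src n t e with splitAt n e in eq
... | inj₁ i = splitAt⁻¹-↑ˡ eq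
... | inj₂ j = splitAt⁻¹-↑ʳ eq

-- The arc numbered k ends at vertex s: at v₁ (s = 0) if it closes the cycle (k + 1 = n) or the tail
-- (k + 1 = N), at vertex k + 1 otherwise.
HeadIndex : ℕ → ℕ → ℕ → ℕ → Set
HeadIndex n N k s = (suc k ≡ n ⊎ suc k ≡ N) × s ≡ 0 ⊎ (suc k ≢ n × suc k ≢ N) × s ≡ suc k

headIndex-next : ∀ a t (i : Fin (suc a)) → HeadIndex (suc a) (suc a + t) (toℕ i) (toℕ (next i))
headIndex-next a t i with suc (toℕ i) ℕ.<? suc a
... | yes i+1<n = inj₂ ((ℕ.<⇒≢ i+1<n , ℕ.<⇒≢ (ℕ.<-≤-trans i+1<n (ℕ.m≤m+n (suc a) t))) , toℕ-fromℕ< i+1<n)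
... | no  i+1≮n = inj₁ (inj₁ (ℕ.≤-antisym (toℕ<n i) (ℕ.≮⇒≥ i+1≮n)) , refl)

headIndex-uNext : ∀ a t (j : Fin t) → HeadIndex (suc a) (suc a + t) (suc a + toℕ j) (toℕ (uNext (suc a) t j))
headIndex-uNext a t j with suc (toℕ j) ℕ.<? t
... | yes j+1<t = inj₂ ((ℕ.>⇒≢ (s≤s (ℕ.m≤m+n (suc a) (toℕ j))) , ℕ.<⇒≢ n+j+1<N) , n+j+1)
  where
  n+j+1 : toℕ (suc a ↑ʳ fromℕ< j+1<t) ≡ suc (suc a + toℕ j)
  n+j+1 = trans (toℕ-↑ʳ (suc a) _) (trans (cong (λ k → suc a + k) (toℕ-fromℕ< j+1<t)) (+-suc (suc a) (toℕ j)))
  n+j+1<N : suc (suc a + toℕ j) < suc a + t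
  n+j+1<N = subst (_< suc a + t) (+-suc (suc a) (toℕ j)) (ℕ.+-monoʳ-< (suc a) j+1<t)
... | no  j+1≮t = inj₁ (inj₂ n+j+1≡N , refl)
  where
  n+j+1≡N : suc (suc a + toℕ j) ≡ suc a + t
  n+j+1≡N = trans (sym (+-suc (suc a) (toℕ j))) (cong (λ k → suc a + k) (ℕ.≤-antisym (toℕ<n j) (ℕ.≮⇒≥ j+1≮t)))

tadpole-tgt : ∀ a t (e : Fin (suc a + t)) →
  HeadIndex (suc a) (suc a + t) (toℕ e) (toℕ (tgt (tadpole (suc a) t) e))
tadpole-tgt a t e with splitAt (suc a) e in eq
... | inj₁ i = subst₂ (HeadIndex (suc a) (suc a + t))
                      (trans (sym (toℕ-↑ˡ i t)) (cong toℕ (splitAt⁻¹-↑ˡ eq)))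
                      (sym (toℕ-↑ˡ (next i) t))
                      (headIndex-next a t i)
... | inj₂ j = subst (λ k → HeadIndex (suc a) (suc a + t) k _)
                     (trans (sym (toℕ-↑ʳ (suc a) j)) (cong toℕ (splitAt⁻¹-↑ʳ eq)))
                     (headIndex-uNext a t j)

tadpole-tgt≡zero : ∀ a t (e : Fin (suc a + t)) →
  tgt (tadpole (suc a) t) e ≡ zero ⇔ (suc (toℕ e) ≡ suc a ⊎ suc (toℕ e) ≡ suc a + t)
tadpole-tgt≡zero a t e = mk⇔ into from
  where
  into : tgt (tadpole (suc a) t) e ≡ zero → suc (toℕ e) ≡ suc a ⊎ suc (toℕ e) ≡ suc a + t
  into head≡0 with tadpole-tgt a t e
  ... | inj₁ (closing , _) = closing
  ... | inj₂ (_ , s≡e+1)   = contradiction (trans (sym s≡e+1) (cong toℕ head≡0)) λ ()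
  from : suc (toℕ e) ≡ suc a ⊎ suc (toℕ e) ≡ suc a + t → tgt (tadpole (suc a) t) e ≡ zero
  from closing with tadpole-tgt a t e
  ... | inj₁ (_ , s≡0)            = toℕ-injective s≡0
  ... | inj₂ ((e+1≢n , e+1≢N) , _) = contradiction closing [ e+1≢n , e+1≢N ]′

tadpole-tgt≡suc : ∀ a t (e : Fin (suc a + t)) (y : Fin (a + t)) →
  tgt (tadpole (suc a) t) e ≡ suc y ⇔ (toℕ e ≡ toℕ y × suc (toℕ y) ≢ suc a)
tadpole-tgt≡suc a t e y = mk⇔ into from
  where
  into : tgt (tadpole (suc a) t) e ≡ suc y → toℕ e ≡ toℕ y × suc (toℕ y) ≢ suc a
  into head≡y+1 with tadpole-tgt a t e
  ... | inj₁ (_ , s≡0) = contradiction (trans (sym s≡0) (cong toℕ head≡y+1)) λ ()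
  ... | inj₂ ((e+1≢n , _) , s≡e+1) = e≡y , subst (λ k → suc k ≢ suc a) e≡y e+1≢n
    where e≡y = ℕ.suc-injective (trans (sym s≡e+1) (cong toℕ head≡y+1))
  from : toℕ e ≡ toℕ y × suc (toℕ y) ≢ suc a → tgt (tadpole (suc a) t) e ≡ suc y
  from (e≡y , y+1≢n) with tadpole-tgt a t e
  ... | inj₁ (inj₁ e+1≡n , _) = contradiction (subst (λ k → suc k ≡ suc a) e≡y e+1≡n) y+1≢n
  ... | inj₁ (inj₂ e+1≡N , _) = contradiction (ℕ.suc-injective (trans (cong suc (sym e≡y)) e+1≡N)) (ℕ.<⇒≢ (toℕ<n y))
  ... | inj₂ (_ , s≡e+1)      = toℕ-injective (trans s≡e+1 (cong suc e≡y))

tadpole-outflow : ∀ n t (lab : Fin (n + t) ⊎ Fin (n + t) → ℕ) x → outflow (tadpole n t) lab x ≡ + lab (inj₂ x)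
tadpole-outflow n t lab x = fibreSum-single (src (tadpole n t)) (arcValue (tadpole n t) lab) x x (tadpole-src n t x)
  λ e src≡x → trans (sym (tadpole-src n t e)) src≡x

module _ {a t} (lab : Fin (suc a + t) ⊎ Fin (suc a + t) → ℕ) where

  private
    G = tadpole (suc a) t

  inflow-u₁ : (y : Fin (a + t)) → toℕ y ≡ a → inflow (tadpole (suc a) t) lab (suc y) ≡ + 0
  inflow-u₁ y y≡a = fibreSum-empty (tgt G) (arcValue G lab) (suc y) λ e tgt≡y+1 →
    proj₂ (Equivalence.to (tadpole-tgt≡suc a t e y) tgt≡y+1) (cong suc y≡a)

  inflow-suc : (y : Fin (a + t)) → toℕ y ≢ a → inflow (tadpole (suc a) t) lab (suc y) ≡ + lab (inj₂ (inject₁ y))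
  inflow-suc y y≢a = fibreSum-single (tgt G) (arcValue G lab) (suc y) (inject₁ y)
    (Equivalence.from (tadpole-tgt≡suc a t (inject₁ y) y) (toℕ-inject₁ y , y≢a ∘ ℕ.suc-injective))
    λ e tgt≡y+1 → toℕ-injective
      (trans (proj₁ (Equivalence.to (tadpole-tgt≡suc a t e y) tgt≡y+1)) (sym (toℕ-inject₁ y)))

arc-vₙv₁ arc-uₜv₁ : ∀ a t → Fin (suc a + t)
arc-vₙv₁ a t = fromℕ a ↑ˡ t
arc-uₜv₁ a t = fromℕ (a + t)

toℕ-arc-vₙv₁ : ∀ a t → toℕ (arc-vₙv₁ a t) ≡ a
toℕ-arc-vₙv₁ a t = trans (toℕ-↑ˡ (fromℕ a) t) (toℕ-fromℕ a)

toℕ-arc-uₜv₁ : ∀ a t → toℕ (arc-uₜv₁ a t) ≡ a + t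
toℕ-arc-uₜv₁ a t = toℕ-fromℕ (a + t)

module _ {a b} (lab : Fin (suc a + suc b) ⊎ Fin (suc a + suc b) → ℕ) where

  inflow-v₁ : inflow (tadpole (suc a) (suc b)) lab zero
            ≡ + (lab (inj₂ (arc-vₙv₁ a (suc b))) + lab (inj₂ (arc-uₜv₁ a (suc b))))
  inflow-v₁ = begin
    inflow G lab zero                  ≡⟨ fibreSum-pair (tgt G) (arcValue G lab) zero p q p≢q
                                            (tgt≡0.from (inj₁ (cong suc toℕ-p)))
                                            (tgt≡0.from (inj₂ (cong suc toℕ-q)))
                                            fibre ⟩
    + lab (inj₂ p) ℤ.+ + lab (inj₂ q)  ≡⟨ ℤ.pos-+ (lab (inj₂ p)) (lab (inj₂ q)) ⟨
    + (lab (inj₂ p) + lab (inj₂ q))    ∎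
    where
    t = suc b
    G = tadpole (suc a) t
    p = arc-vₙv₁ a t
    q = arc-uₜv₁ a t
    toℕ-p = toℕ-arc-vₙv₁ a t
    toℕ-q = toℕ-arc-uₜv₁ a t
    p≢q : p ≢ q
    p≢q p≡q = ℕ.<⇒≢ (ℕ.m<m+n a z<s) (trans (sym toℕ-p) (trans (cong toℕ p≡q) toℕ-q))
    module tgt≡0 {e} = Equivalence (tadpole-tgt≡zero a t e)
    fibre : ∀ e → tgt G e ≡ zero → e ≡ p ⊎ e ≡ q
    fibre e tgt≡0 with tgt≡0.to tgt≡0
    ... | inj₁ e+1≡n = inj₁ (toℕ-injective (trans (ℕ.suc-injective e+1≡n) (sym toℕ-p)))
    ... | inj₂ e+1≡N = inj₂ (toℕ-injective (trans (ℕ.suc-injective e+1≡N) (sym toℕ-q)))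

labelIndex↔ : ∀ n t → (Fin (n + t) ⊎ Fin (n + t)) ↔ Fin ((n + t) + (n + t))
labelIndex↔ n t = ↔-trans (↔-refl ⊎-↔ rotate↔ n t) (↔-trans swap-↔ (↔-sym +↔⊎))

tadpoleLabel : ∀ n t → Fin (n + t) ⊎ Fin (n + t) → ℕ
tadpoleLabel n t = rank (labelIndex↔ n t)

arcLabel : ∀ n t → Fin (n + t) → ℕ
arcLabel n t = rank (rotate↔ n t)

tadpoleLabel-vertex : ∀ n t x → tadpoleLabel n t (inj₁ x) ≡ n + t + 1 + toℕ x
tadpoleLabel-vertex n t x = begin
  suc (toℕ ((n + t) ↑ʳ x)) ≡⟨ cong suc (toℕ-↑ʳ (n + t) x) ⟩
  suc (n + t + toℕ x)      ≡⟨ +-suc (n + t) (toℕ x) ⟨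
  n + t + suc (toℕ x)      ≡⟨ ℕ.+-assoc (n + t) 1 (toℕ x) ⟨
  n + t + 1 + toℕ x        ∎

tadpoleLabel-arc : ∀ n t e → tadpoleLabel n t (inj₂ e) ≡ arcLabel n t e
tadpoleLabel-arc n t e = cong suc (toℕ-↑ˡ (rotate n t e) (n + t))

tadpole-isTotalLabeling : ∀ n t → IsTotalLabeling (tadpole n t) (tadpoleLabel n t)
tadpole-isTotalLabeling n t = rank-injective φ , rank-bounded φ , rank-onto φ
  where φ = labelIndex↔ n t

tadpole-isStrongStar : ∀ n t → IsStrongStar (tadpole n t) (tadpoleLabel n t)
tadpole-isStrongStar n t = bounded , onto
  where
  bounded : ∀ e → 1 ≤ tadpoleLabel n t (inj₂ e) × tadpoleLabel n t (inj₂ e) ≤ n + t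
  bounded e = subst (λ k → 1 ≤ k × k ≤ n + t) (sym (tadpoleLabel-arc n t e)) (rank-bounded (rotate↔ n t) e)
  onto : ∀ k → 1 ≤ k → k ≤ n + t → ∃ λ e → tadpoleLabel n t (inj₂ e) ≡ k
  onto k 1≤k k≤n+t = map₂ (λ {e} → trans (tadpoleLabel-arc n t e)) (rank-onto (rotate↔ n t) k 1≤k k≤n+t)

arcLabel-cycle : ∀ n t (e : Fin (n + t)) → toℕ e < n → arcLabel n t e ≡ suc (t + toℕ e)
arcLabel-cycle n t e e<n = cong suc (toℕ-rotate-< n t e e<n)

arcLabel-tail : ∀ n t (e : Fin (n + t)) → n ≤ toℕ e → arcLabel n t e ≡ suc (toℕ e ∸ n)
arcLabel-tail n t e n≤e = cong suc (toℕ-rotate-≥ n t e n≤e)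

arcLabel-suc : ∀ a t (y : Fin (a + t)) → toℕ y ≢ a →
               arcLabel (suc a) t (suc y) ≡ suc (arcLabel (suc a) t (inject₁ y))
arcLabel-suc a t y y≢a with ℕ.<-cmp (toℕ y) a
... | tri< y<a _ _ = begin
  arcLabel (suc a) t (suc y)          ≡⟨ arcLabel-cycle (suc a) t (suc y) (s≤s y<a) ⟩
  suc (t + suc (toℕ y))               ≡⟨ cong suc (+-suc t (toℕ y)) ⟩
  suc (suc (t + toℕ y))               ≡⟨ cong (λ k → suc (suc (t + k))) (toℕ-inject₁ y) ⟨
  suc (suc (t + toℕ (inject₁ y)))     ≡⟨ cong suc (arcLabel-cycle (suc a) t (inject₁ y) y′<n) ⟨
  suc (arcLabel (suc a) t (inject₁ y)) ∎
  where y′<n = subst (_< suc a) (sym (toℕ-inject₁ y)) (ℕ.m<n⇒m<1+n y<a)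
... | tri≈ _ y≡a _ = contradiction y≡a y≢a
... | tri> _ _ a<y = begin
  arcLabel (suc a) t (suc y)               ≡⟨ arcLabel-tail (suc a) t (suc y) (ℕ.m≤n⇒m≤1+n a<y) ⟩
  suc (suc (toℕ y) ∸ suc a)                ≡⟨ cong suc (ℕ.+-∸-assoc 1 a<y) ⟩
  suc (suc (toℕ y ∸ suc a))                ≡⟨ cong (λ k → suc (suc (k ∸ suc a))) (toℕ-inject₁ y) ⟨
  suc (suc (toℕ (inject₁ y) ∸ suc a))      ≡⟨ cong suc (arcLabel-tail (suc a) t (inject₁ y) n≤y′) ⟨
  suc (arcLabel (suc a) t (inject₁ y))     ∎
  where n≤y′ = subst (suc a ≤_) (sym (toℕ-inject₁ y)) a<y

arcLabel-vₙv₁ : ∀ a t → arcLabel (suc a) t (arc-vₙv₁ a t) ≡ suc (t + a)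
arcLabel-vₙv₁ a t = begin
  arcLabel (suc a) t (arc-vₙv₁ a t)  ≡⟨ arcLabel-cycle (suc a) t (arc-vₙv₁ a t) a<n ⟩
  suc (t + toℕ (arc-vₙv₁ a t))       ≡⟨ cong (λ k → suc (t + k)) (toℕ-arc-vₙv₁ a t) ⟩
  suc (t + a)                        ∎
  where a<n = subst (_< suc a) (sym (toℕ-arc-vₙv₁ a t)) ℕ.≤-refl

arcLabel-uₜv₁ : ∀ a b → arcLabel (suc a) (suc b) (arc-uₜv₁ a (suc b)) ≡ suc b
arcLabel-uₜv₁ a b = begin
  arcLabel (suc a) (suc b) (arc-uₜv₁ a (suc b))  ≡⟨ arcLabel-tail (suc a) (suc b) _ n≤q ⟩
  suc (toℕ (arc-uₜv₁ a (suc b)) ∸ suc a)         ≡⟨ cong (λ k → suc (k ∸ suc a)) toℕ-q ⟩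
  suc (a + b ∸ a)                                ≡⟨ cong suc (ℕ.m+n∸m≡n a b) ⟩
  suc b                                          ∎
  where
  toℕ-q : toℕ (arc-uₜv₁ a (suc b)) ≡ suc (a + b)
  toℕ-q = trans (toℕ-arc-uₜv₁ a (suc b)) (+-suc a b)
  n≤q = subst (suc a ≤_) (sym toℕ-q) (s≤s (ℕ.m≤m+n a b))

arcLabel-u₁u₂ : ∀ a t (y : Fin (a + t)) → toℕ y ≡ a → arcLabel (suc a) t (suc y) ≡ 1
arcLabel-u₁u₂ a t y y≡a = begin
  arcLabel (suc a) t (suc y)  ≡⟨ arcLabel-tail (suc a) t (suc y) (s≤s (ℕ.≤-reflexive (sym y≡a))) ⟩
  suc (toℕ y ∸ a)             ≡⟨ cong (λ k → suc (k ∸ a)) y≡a ⟩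
  suc (a ∸ a)                 ≡⟨ cong suc (ℕ.n∸n≡0 a) ⟩
  1                           ∎

module _ (a b : ℕ) where

  private
    n = suc a
    t = suc b
    N = n + t
    G = tadpole n t
    lab = tadpoleLabel n t
    -- vertex k gets the weight N + 1 + (k − 1 mod N)
    π = rotate↔ 1 (a + t)

    label : ∀ e → lab (inj₂ e) ≡ arcLabel n t e
    label = tadpoleLabel-arc n t

    π-zero : toℕ (Inverse.to π zero) ≡ a + t + 0
    π-zero = toℕ-rotate-< 1 (a + t) zero z<s

    π-suc : ∀ y → toℕ (Inverse.to π (suc y)) ≡ toℕ y
    π-suc y = toℕ-rotate-≥ 1 (a + t) (suc y) (s≤s z≤n)

  tadpole-weight : ∀ x → wt⁻ G lab x ≡ + (N + 1 + toℕ (Inverse.to π x))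
  tadpole-weight zero =
    wt⁻-fromFlows G lab zero {N + 1} (tadpoleLabel-vertex n t zero)
      (inflow-v₁ lab) (tadpole-outflow n t lab zero) balance
    where
    arithmetic : ∀ a t → suc (t + a) + t + 0 ≡ suc (t + 0) + (a + t + 0)
    arithmetic = solve-∀
    balance : lab (inj₂ (arc-vₙv₁ a t)) + lab (inj₂ (arc-uₜv₁ a t)) + 0 ≡ lab (inj₂ zero) + toℕ (Inverse.to π zero)
    balance = begin
      lab (inj₂ (arc-vₙv₁ a t)) + lab (inj₂ (arc-uₜv₁ a t)) + 0
        ≡⟨ cong₂ (λ u v → u + v + 0) (trans (label (arc-vₙv₁ a t)) (arcLabel-vₙv₁ a t))
                                     (trans (label (arc-uₜv₁ a t)) (arcLabel-uₜv₁ a b)) ⟩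
      suc (t + a) + t + 0
        ≡⟨ arithmetic a t ⟩
      suc (t + 0) + (a + t + 0)
        ≡⟨ cong₂ _+_ (trans (label zero) (arcLabel-cycle n t zero z<s)) π-zero ⟨
      lab (inj₂ zero) + toℕ (Inverse.to π zero) ∎
  tadpole-weight (suc y) with toℕ y ℕ.≟ a
  ... | yes y≡a =
    wt⁻-fromFlows G lab (suc y) {N + 1} (tadpoleLabel-vertex n t (suc y))
      (inflow-u₁ lab y y≡a) (tadpole-outflow n t lab (suc y))
      (sym (cong₂ _+_ (trans (label (suc y)) (arcLabel-u₁u₂ a t y y≡a)) (π-suc y)))
  ... | no y≢a =
    wt⁻-fromFlows G lab (suc y) {N + 1} (tadpoleLabel-vertex n t (suc y))
      (inflow-suc lab y y≢a) (tadpole-outflow n t lab (suc y)) balance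
    where
    balance : lab (inj₂ (inject₁ y)) + suc (toℕ y) ≡ lab (inj₂ (suc y)) + toℕ (Inverse.to π (suc y))
    balance = begin
      lab (inj₂ (inject₁ y)) + suc (toℕ y)              ≡⟨ +-suc _ (toℕ y) ⟩
      suc (lab (inj₂ (inject₁ y))) + toℕ y              ≡⟨ cong (λ k → suc k + toℕ y) (label (inject₁ y)) ⟩
      suc (arcLabel n t (inject₁ y)) + toℕ y            ≡⟨ cong₂ _+_ (arcLabel-suc a t y y≢a) (π-suc y) ⟨
      arcLabel n t (suc y) + toℕ (Inverse.to π (suc y)) ≡⟨ cong (_+ toℕ (Inverse.to π (suc y))) (label (suc y)) ⟨
      lab (inj₂ (suc y)) + toℕ (Inverse.to π (suc y))   ∎

  tadpole-isSVAL : IsSVAL G (+ (N + 1)) (+ 1) lab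
  tadpole-isSVAL = isSVAL-fromWeights G lab π (tadpole-isTotalLabeling n t) tadpole-weight

-- The construction only needs n ≥ 1 and t ≥ 1.
mainTheorem12 : ∀ (n t : ℕ) → 3 ≤ n → 1 ≤ t →
    ∃ λ (lab : Fin (n + t) ⊎ Fin (n + t) → ℕ) →
    IsSVAL (tadpole n t) (+ (n + t + 1)) (+ 1) lab × IsStrongStar (tadpole n t) lab
mainTheorem12 (suc a) (suc b) _ _ =
  tadpoleLabel (suc a) (suc b) , tadpole-isSVAL a b , tadpole-isStrongStar (suc a) (suc b)
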